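{- Let $A=(0,0)$ and $B=(m,b)\in\mathbb Z^2$ with $m>0$, and let $\eta_+,\eta_-:A\to B$ be two Schröder paths that do not intersect except at their endpoints $A$ and $B$, with $\eta_+$ above $\eta_-$. Let $\Gamma$ be the closed region between $\eta_-$ and $\eta_+$. Let $0<\ell<m$, let $\gamma=\{x=\ell\}\cap\Gamma$, and for $k\in\mathbb Z$ let $F(k)$ be the number of Schröder paths $\zeta:A\to B$ lying inside $\Gamma$ that contain the point $(\ell,k)$. Then $$F(k)^2\ \ge\ F(k+2)\,F(k-2)$$ for all $k\in\mathbb Z$ such that $(\ell,k+2)\in\gamma$ and $(\ell,k-2)\in\gamma$.
   Context: A Schröder path here is a lattice path with steps $(1,1)$, $(1,-1)$ and $(2,0)$ (no nonnegativity constraint). A path contains the point $(\ell,k)$ if $(\ell,k)$ is one of its vertices. A path lies inside $\Gamma$ if it lies in the closed region bounded by $\eta_-$ and $\eta_+$. -}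

module Defs where

open import Data.Nat as ℕ using (ℕ; zero; suc)
open import Data.Integer as ℤ using (ℤ; 0ℤ; 1ℤ)
import Data.Integer.Properties as ℤP
open import Data.List using (List; []; _∷_; _++_; map; length; filter; upTo)
open import Data.List.Relation.Unary.All using (All; all?)
open import Data.Product using (_×_; _,_)
open import Data.Product.Properties using (≡-dec)
import Data.Nat.Properties as ℕP
open import Relation.Nullary using (Dec)
open import Relation.Nullary.Decidable using (_×-dec_)
open import Relation.Binary.PropositionalEquality using (_≡_)
import Data.List.Membership.DecPropositional as DecMem

-- Steps of a Schröder path: U = (1,1), D = (1,-1), H = (2,0).
data Step : Set where
  U D H : Step

-- A path is the list of its steps, read from the start point A = (0,0).
Path : Set
Path = List Step

width : Path → ℕ
width []      = 0
width (U ∷ p) = suc (width p)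
width (D ∷ p) = suc (width p)
width (H ∷ p) = suc (suc (width p))

endFrom : ℤ → Path → ℤ
endFrom y []      = y
endFrom y (U ∷ p) = endFrom (y ℤ.+ 1ℤ) p
endFrom y (D ∷ p) = endFrom (y ℤ.- 1ℤ) p
endFrom y (H ∷ p) = endFrom y p

IsSchröder : ℕ → ℤ → Path → Set
IsSchröder m b p = width p ≡ m × endFrom 0ℤ p ≡ b

-- The path, viewed as a piecewise-linear function of x, evaluated at the
-- integer abscissa x (measured from the start, which has height y).
hgtFrom : ℤ → Path → ℕ → ℤ
hgtFrom y []      x             = y
hgtFrom y (U ∷ p) zero          = y
hgtFrom y (U ∷ p) (suc x)       = hgtFrom (y ℤ.+ 1ℤ) p x
hgtFrom y (D ∷ p) zero          = y
hgtFrom y (D ∷ p) (suc x)       = hgtFrom (y ℤ.- 1ℤ) p x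
hgtFrom y (H ∷ p) zero          = y
hgtFrom y (H ∷ p) (suc zero)    = y
hgtFrom y (H ∷ p) (suc (suc x)) = hgtFrom y p x

height : Path → ℕ → ℤ
height = hgtFrom 0ℤ

verticesFrom : ℕ → ℤ → Path → List (ℕ × ℤ)
verticesFrom x y []      = (x , y) ∷ []
verticesFrom x y (U ∷ p) = (x , y) ∷ verticesFrom (suc x) (y ℤ.+ 1ℤ) p
verticesFrom x y (D ∷ p) = (x , y) ∷ verticesFrom (suc x) (y ℤ.- 1ℤ) p
verticesFrom x y (H ∷ p) = (x , y) ∷ verticesFrom (suc (suc x)) y p

module PtMem = DecMem {A = ℕ × ℤ} (≡-dec ℕP._≟_ ℤP._≟_)

Contains : Path → ℕ → ℤ → Set
Contains p ℓ k = PtMem._∈_ (ℓ , k) (verticesFrom 0 0ℤ p)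

-- η₋ and η₊ (both from A to B, of width m) meet only at A and B, with η₊ above η₋.
-- All paths are linear between consecutive integer abscissas, so this is
-- equivalent to strict inequality at the integer abscissas 0 < x < m.
NonIntersectingAbove : ℕ → Path → Path → Set
NonIntersectingAbove m ηm ηp =
  ∀ x → 0 ℕ.< x → x ℕ.< m → height ηm x ℤ.< height ηp x

-- ζ lies in the closed region Γ between η₋ and η₊ (paths of width m).
-- Again piecewise linearity with integer breakpoints reduces this to the
-- integer abscissas 0,1,…,m.
InsideΓ : ℕ → Path → Path → Path → Set
InsideΓ m ηm ηp ζ =
  All (λ x → height ηm x ℤ.≤ height ζ x × height ζ x ℤ.≤ height ηp x) (upTo (suc m))

insideΓ? : ∀ m ηm ηp ζ → Dec (InsideΓ m ηm ηp ζ)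
insideΓ? m ηm ηp ζ =
  all? (λ x → (height ηm x ℤP.≤? height ζ x) ×-dec (height ζ x ℤP.≤? height ηp x))
       (upTo (suc m))

InGamma : Path → Path → ℕ → ℤ → Set
InGamma ηm ηp ℓ k = height ηm ℓ ℤ.≤ k × k ℤ.≤ height ηp ℓ

stepLists : ℕ → List Path
stepLists zero          = [] ∷ []
stepLists (suc zero)    = (U ∷ []) ∷ (D ∷ []) ∷ []
stepLists (suc (suc n)) =
  map (U ∷_) (stepLists (suc n)) ++ map (D ∷_) (stepLists (suc n)) ++ map (H ∷_) (stepLists n)

F : ℕ → ℤ → Path → Path → ℕ → ℤ → ℕ
F m b ηm ηp ℓ k =
  length (filter (λ ζ → (endFrom 0ℤ ζ ℤP.≟ b) ×-dec (insideΓ? m ηm ηp ζ ×-dec PtMem._∈?_ (ℓ , k) (verticesFrom 0 0ℤ ζ)))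
                 (stepLists m))

-- Take ζ₁ through (ℓ, k + 2) and ζ₂ through (ℓ, k − 2), both ending at B.
-- Lower ζ₁ by 2 and raise ζ₂ by 2.  Walking from x = ℓ to the right, ζ₁ starts 4 above ζ₂ and
-- ends at the same height; since vertex heights have the parity of the abscissa (an H step is
-- flat over two units), there is a first common vertex at which ζ₁ is exactly 2 above ζ₂, and
-- before it ζ₁ stays at least 2 above ζ₂.  The same holds walking to the left.  Cutting at these
-- two vertices and exchanging the outer pieces gives two paths through (ℓ, k) whose heights lie,
-- at every abscissa, between those of ζ₁ and ζ₂; in particular they stay inside Γ.  Applied to
-- the new pair the construction finds the same two vertices and restores (ζ₁, ζ₂), so it is an
-- injection from pairs counted by F(k + 2) F(k − 2) into pairs counted by F(k)².

module Submission where

open import Defs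
open import Data.Nat using (ℕ; _*_; _≤_; _<_)
open import Data.Integer using (ℤ; _+_; _-_; +_)

open import Data.Nat as ℕ using (zero; suc; z≤n; s≤s)
import Data.Nat.Properties as ℕP
open import Data.Integer as ℤ using (0ℤ; 1ℤ)
import Data.Integer.Properties as ℤP
open import Data.Integer.Tactic.RingSolver using (solve-∀)
open import Algebra.Properties.CommutativeSemigroup ℤP.+-commutativeSemigroup using (xy∙z≈xz∙y)
open import Algebra.Properties.AbelianGroup ℤP.+-0-abelianGroup using (∙-cancelʳ)
open import Data.List using (List; []; _∷_; _++_; map; length; filter; cartesianProduct)
import Data.List.Properties as LP
open import Data.List.Membership.Propositional using (_∈_)
open import Data.List.Membership.Propositional.Properties
  using (∈-map⁺; ∈-map⁻; ∈-++⁺ˡ; ∈-++⁺ʳ; ∈-++⁻; ∈-∃++; ∈-filter⁺; ∈-filter⁻; ∈-cartesianProduct⁺; ∈-cartesianProduct⁻)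
open import Data.List.Relation.Unary.Any using (here; there)
import Data.List.Relation.Unary.All as All
open import Data.List.Relation.Unary.AllPairs using ([]; _∷_)
open import Data.List.Relation.Unary.Unique.Propositional using (Unique)
import Data.List.Relation.Unary.Unique.Propositional.Properties as Unique
open import Data.List.Relation.Binary.Disjoint.Propositional using (Disjoint)
open import Data.Product using (_×_; _,_; proj₁; proj₂; ∃₂)
import Data.Product as Prod
open import Data.Sum using (inj₁; inj₂; [_,_]′)
open import Data.Empty using (⊥-elim)
open import Function using (_∘_)
open import Relation.Binary.PropositionalEquality
open import Relation.Nullary using (Dec)
open import Relation.Nullary.Decidable using (_×-dec_)

width-++ : ∀ p q → width (p ++ q) ≡ width p ℕ.+ width q
width-++ []      q = refl
width-++ (U ∷ p) q = cong suc (width-++ p q)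
width-++ (D ∷ p) q = cong suc (width-++ p q)
width-++ (H ∷ p) q = cong (suc ∘ suc) (width-++ p q)

endFrom-++ : ∀ y p q → endFrom y (p ++ q) ≡ endFrom (endFrom y p) q
endFrom-++ y []      q = refl
endFrom-++ y (U ∷ p) q = endFrom-++ (y + 1ℤ) p q
endFrom-++ y (D ∷ p) q = endFrom-++ (y - 1ℤ) p q
endFrom-++ y (H ∷ p) q = endFrom-++ y p q

width-++-cong : ∀ p p′ q → width p ≡ width p′ → width (p ++ q) ≡ width (p′ ++ q)
width-++-cong p p′ q w≡ = trans (width-++ p q) (trans (cong (ℕ._+ width q) w≡) (sym (width-++ p′ q)))

endFrom-++-cong : ∀ y y′ p p′ q → endFrom y p ≡ endFrom y′ p′ → endFrom y (p ++ q) ≡ endFrom y′ (p′ ++ q)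
endFrom-++-cong y y′ p p′ q e≡ = trans (endFrom-++ y p q) (trans (cong (λ v → endFrom v q) e≡) (sym (endFrom-++ y′ p′ q)))

hgtFrom-zero : ∀ y p → hgtFrom y p 0 ≡ y
hgtFrom-zero y []      = refl
hgtFrom-zero y (U ∷ p) = refl
hgtFrom-zero y (D ∷ p) = refl
hgtFrom-zero y (H ∷ p) = refl

hgtFrom-++ˡ : ∀ y p q {z} → z ≤ width p → hgtFrom y (p ++ q) z ≡ hgtFrom y p z
hgtFrom-++ˡ y []      q {zero}        _                = hgtFrom-zero y q
hgtFrom-++ˡ y (U ∷ p) q {zero}        _                = refl
hgtFrom-++ˡ y (U ∷ p) q {suc z}       (s≤s z≤w)        = hgtFrom-++ˡ (y + 1ℤ) p q z≤w
hgtFrom-++ˡ y (D ∷ p) q {zero}        _                = refl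
hgtFrom-++ˡ y (D ∷ p) q {suc z}       (s≤s z≤w)        = hgtFrom-++ˡ (y - 1ℤ) p q z≤w
hgtFrom-++ˡ y (H ∷ p) q {zero}        _                = refl
hgtFrom-++ˡ y (H ∷ p) q {suc zero}    _                = refl
hgtFrom-++ˡ y (H ∷ p) q {suc (suc z)} (s≤s (s≤s z≤w)) = hgtFrom-++ˡ y p q z≤w

hgtFrom-++ʳ : ∀ y p q z → hgtFrom y (p ++ q) (width p ℕ.+ z) ≡ hgtFrom (endFrom y p) q z
hgtFrom-++ʳ y []      q z = refl
hgtFrom-++ʳ y (U ∷ p) q z = hgtFrom-++ʳ (y + 1ℤ) p q z
hgtFrom-++ʳ y (D ∷ p) q z = hgtFrom-++ʳ (y - 1ℤ) p q z
hgtFrom-++ʳ y (H ∷ p) q z = hgtFrom-++ʳ y p q z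

hgtFrom-++-prefix : ∀ y p q q′ {z} → z ≤ width p → hgtFrom y (p ++ q) z ≡ hgtFrom y (p ++ q′) z
hgtFrom-++-prefix y p q q′ z≤ = trans (hgtFrom-++ˡ y p q z≤) (sym (hgtFrom-++ˡ y p q′ z≤))

hgtFrom-++-suffix : ∀ {y y′ p p′} q d → width p ≡ width p′ → endFrom y p ≡ endFrom y′ p′ →
  hgtFrom y (p ++ q) (width p ℕ.+ d) ≡ hgtFrom y′ (p′ ++ q) (width p′ ℕ.+ d)
hgtFrom-++-suffix {y} {y′} {p} {p′} q d w≡ e≡ = begin
  hgtFrom y (p ++ q) (width p ℕ.+ d)     ≡⟨ hgtFrom-++ʳ y p q d ⟩
  hgtFrom (endFrom y p) q d              ≡⟨ cong (λ v → hgtFrom v q d) e≡ ⟩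
  hgtFrom (endFrom y′ p′) q d            ≡⟨ hgtFrom-++ʳ y′ p′ q d ⟨
  hgtFrom y′ (p′ ++ q) (width p′ ℕ.+ d)  ∎
  where open ≡-Reasoning

endFrom-+ : ∀ y d p → endFrom (y + d) p ≡ endFrom y p + d
endFrom-+ y d []      = refl
endFrom-+ y d (U ∷ p) = trans (cong (λ w → endFrom w p) (xy∙z≈xz∙y y d 1ℤ)) (endFrom-+ (y + 1ℤ) d p)
endFrom-+ y d (D ∷ p) = trans (cong (λ w → endFrom w p) (xy∙z≈xz∙y y d (ℤ.- 1ℤ))) (endFrom-+ (y - 1ℤ) d p)
endFrom-+ y d (H ∷ p) = endFrom-+ y d p

hgtFrom-+ : ∀ y d p z → hgtFrom (y + d) p z ≡ hgtFrom y p z + d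
hgtFrom-+ y d []      z             = refl
hgtFrom-+ y d (U ∷ p) zero          = refl
hgtFrom-+ y d (U ∷ p) (suc z)       =
  trans (cong (λ w → hgtFrom w p z) (xy∙z≈xz∙y y d 1ℤ)) (hgtFrom-+ (y + 1ℤ) d p z)
hgtFrom-+ y d (D ∷ p) zero          = refl
hgtFrom-+ y d (D ∷ p) (suc z)       =
  trans (cong (λ w → hgtFrom w p z) (xy∙z≈xz∙y y d (ℤ.- 1ℤ))) (hgtFrom-+ (y - 1ℤ) d p z)
hgtFrom-+ y d (H ∷ p) zero          = refl
hgtFrom-+ y d (H ∷ p) (suc zero)    = refl
hgtFrom-+ y d (H ∷ p) (suc (suc z)) = hgtFrom-+ y d p z

-- Reading a path backwards

turn : Step → Step
turn U = D
turn D = U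
turn H = H

backwards : Path → Path
backwards []      = []
backwards (s ∷ p) = backwards p ++ turn s ∷ []

backwards-++ : ∀ p q → backwards (p ++ q) ≡ backwards q ++ backwards p
backwards-++ []      q = sym (LP.++-identityʳ (backwards q))
backwards-++ (s ∷ p) q =
  trans (cong (_++ turn s ∷ []) (backwards-++ p q)) (LP.++-assoc (backwards q) (backwards p) _)

turn-involutive : ∀ s → turn (turn s) ≡ s
turn-involutive U = refl
turn-involutive D = refl
turn-involutive H = refl

backwards-involutive : ∀ p → backwards (backwards p) ≡ p
backwards-involutive []      = refl
backwards-involutive (s ∷ p) =
  trans (backwards-++ (backwards p) (turn s ∷ []))
        (cong₂ _∷_ (turn-involutive s) (backwards-involutive p))

width-turn : ∀ s → width (turn s ∷ []) ≡ width (s ∷ [])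
width-turn U = refl
width-turn D = refl
width-turn H = refl

width-backwards : ∀ p → width (backwards p) ≡ width p
width-backwards []      = refl
width-backwards (s ∷ p) = begin
  width (backwards p ++ turn s ∷ [])      ≡⟨ width-++ (backwards p) (turn s ∷ []) ⟩
  width (backwards p) ℕ.+ width (turn s ∷ []) ≡⟨ cong₂ ℕ._+_ (width-backwards p) (width-turn s) ⟩
  width p ℕ.+ width (s ∷ [])              ≡⟨ ℕP.+-comm (width p) _ ⟩
  width (s ∷ []) ℕ.+ width p              ≡⟨ width-++ (s ∷ []) p ⟨
  width (s ∷ p)                           ∎
  where open ≡-Reasoning

+1-1 : ∀ y → (y + 1ℤ) - 1ℤ ≡ y
+1-1 = solve-∀

-1+1 : ∀ y → (y - 1ℤ) + 1ℤ ≡ y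
-1+1 = solve-∀

endFrom-turn : ∀ y s → endFrom (endFrom y (s ∷ [])) (turn s ∷ []) ≡ y
endFrom-turn y U = +1-1 y
endFrom-turn y D = -1+1 y
endFrom-turn y H = refl

endFrom-backwards : ∀ y p → endFrom (endFrom y p) (backwards p) ≡ y
endFrom-backwards y []      = refl
endFrom-backwards y (s ∷ p) = begin
  endFrom (endFrom y (s ∷ p)) (backwards (s ∷ p))              ≡⟨ cong (λ v → endFrom v (backwards (s ∷ p))) (endFrom-++ y (s ∷ []) p) ⟩
  endFrom (endFrom y′ p) (backwards p ++ turn s ∷ [])           ≡⟨ endFrom-++ _ (backwards p) _ ⟩
  endFrom (endFrom (endFrom y′ p) (backwards p)) (turn s ∷ []) ≡⟨ cong (λ w → endFrom w (turn s ∷ [])) (endFrom-backwards y′ p) ⟩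
  endFrom y′ (turn s ∷ [])                                     ≡⟨ endFrom-turn y s ⟩
  y                                                            ∎
  where
  open ≡-Reasoning
  y′ = endFrom y (s ∷ [])

hgtFrom-backwards-++ʳ : ∀ y p q n {w} → w ≡ n ℕ.+ width p →
  hgtFrom (endFrom y p) (backwards p ++ q) w ≡ hgtFrom y q n
hgtFrom-backwards-++ʳ y p q n {w} e = begin
  hgtFrom (endFrom y p) (backwards p ++ q) w                           ≡⟨ cong (hgtFrom (endFrom y p) (backwards p ++ q)) w≡ ⟩
  hgtFrom (endFrom y p) (backwards p ++ q) (width (backwards p) ℕ.+ n) ≡⟨ hgtFrom-++ʳ _ (backwards p) q n ⟩
  hgtFrom (endFrom (endFrom y p) (backwards p)) q n                   ≡⟨ cong (λ v → hgtFrom v q n) (endFrom-backwards y p) ⟩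
  hgtFrom y q n                                                       ∎
  where
  open ≡-Reasoning
  w≡ : w ≡ width (backwards p) ℕ.+ n
  w≡ = trans e (trans (ℕP.+-comm n (width p)) (cong (ℕ._+ n) (sym (width-backwards p))))

hgtFrom-backwards : ∀ y p w d → d ℕ.+ w ≡ width p →
  hgtFrom (endFrom y p) (backwards p) w ≡ hgtFrom y p d
hgtFrom-backwards-within : ∀ y p w d {q} → d ℕ.+ w ≡ width p →
  hgtFrom (endFrom y p) (backwards p ++ q) w ≡ hgtFrom y p d

hgtFrom-backwards y []      zero zero          _ = refl
hgtFrom-backwards y (U ∷ p) w    zero          e = trans (hgtFrom-backwards-++ʳ (y + 1ℤ) p _ 1 e) (+1-1 y)
hgtFrom-backwards y (D ∷ p) w    zero          e = trans (hgtFrom-backwards-++ʳ (y - 1ℤ) p _ 1 e) (-1+1 y)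
hgtFrom-backwards y (H ∷ p) w    zero          e = hgtFrom-backwards-++ʳ y p _ 2 e
hgtFrom-backwards y (H ∷ p) w    (suc zero)    e = hgtFrom-backwards-++ʳ y p _ 1 (ℕP.suc-injective e)
hgtFrom-backwards y (U ∷ p) w    (suc d)       e = hgtFrom-backwards-within (y + 1ℤ) p w d (ℕP.suc-injective e)
hgtFrom-backwards y (D ∷ p) w    (suc d)       e = hgtFrom-backwards-within (y - 1ℤ) p w d (ℕP.suc-injective e)
hgtFrom-backwards y (H ∷ p) w    (suc (suc d)) e =
  hgtFrom-backwards-within y p w d (ℕP.suc-injective (ℕP.suc-injective e))

hgtFrom-backwards-within y p w d {q} e =
  trans (hgtFrom-++ˡ _ (backwards p) q (subst (w ≤_) (trans e (sym (width-backwards p))) (ℕP.m≤n+m w d)))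
        (hgtFrom-backwards y p w d e)

cut : ℕ → Path → Path × Path
cut zero          p       = [] , p
cut (suc n)       []      = [] , []
cut (suc n)       (U ∷ p) = Prod.map₁ (U ∷_) (cut n p)
cut (suc n)       (D ∷ p) = Prod.map₁ (D ∷_) (cut n p)
cut (suc zero)    (H ∷ p) = [] , H ∷ p
cut (suc (suc n)) (H ∷ p) = Prod.map₁ (H ∷_) (cut n p)

cut-++ : ∀ ℓ p → proj₁ (cut ℓ p) ++ proj₂ (cut ℓ p) ≡ p
cut-++ zero          p       = refl
cut-++ (suc n)       []      = refl
cut-++ (suc n)       (U ∷ p) = cong (U ∷_) (cut-++ n p)
cut-++ (suc n)       (D ∷ p) = cong (D ∷_) (cut-++ n p)
cut-++ (suc zero)    (H ∷ p) = refl
cut-++ (suc (suc n)) (H ∷ p) = cong (H ∷_) (cut-++ n p)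

cut-width-++ : ∀ L R → cut (width L) (L ++ R) ≡ (L , R)
cut-width-++ []      R = refl
cut-width-++ (U ∷ L) R = cong (Prod.map₁ (U ∷_)) (cut-width-++ L R)
cut-width-++ (D ∷ L) R = cong (Prod.map₁ (D ∷_)) (cut-width-++ L R)
cut-width-++ (H ∷ L) R = cong (Prod.map₁ (H ∷_)) (cut-width-++ L R)

start∈verticesFrom : ∀ x y p → (x , y) ∈ verticesFrom x y p
start∈verticesFrom x y []      = here refl
start∈verticesFrom x y (U ∷ p) = here refl
start∈verticesFrom x y (D ∷ p) = here refl
start∈verticesFrom x y (H ∷ p) = here refl

end-of-prefix∈verticesFrom : ∀ x y L R → (width L ℕ.+ x , endFrom y L) ∈ verticesFrom x y (L ++ R)
end-of-prefix∈verticesFrom x y []      R = start∈verticesFrom x y R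
end-of-prefix∈verticesFrom x y (U ∷ L) R rewrite sym (ℕP.+-suc (width L) x) =
  there (end-of-prefix∈verticesFrom (suc x) (y + 1ℤ) L R)
end-of-prefix∈verticesFrom x y (D ∷ L) R rewrite sym (ℕP.+-suc (width L) x) =
  there (end-of-prefix∈verticesFrom (suc x) (y - 1ℤ) L R)
end-of-prefix∈verticesFrom x y (H ∷ L) R rewrite sym (ℕP.+-suc (width L) x) | sym (ℕP.+-suc (width L) (suc x)) =
  there (end-of-prefix∈verticesFrom (suc (suc x)) y L R)

∈verticesFrom⇒end-of-prefix : ∀ {u v} x y p → (u , v) ∈ verticesFrom x y p →
  ∃₂ λ L R → p ≡ L ++ R × u ≡ width L ℕ.+ x × v ≡ endFrom y L
∈verticesFrom⇒end-of-prefix x y []      (here refl) = [] , [] , refl , refl , refl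
∈verticesFrom⇒end-of-prefix x y (U ∷ p) (here refl) = [] , U ∷ p , refl , refl , refl
∈verticesFrom⇒end-of-prefix x y (D ∷ p) (here refl) = [] , D ∷ p , refl , refl , refl
∈verticesFrom⇒end-of-prefix x y (H ∷ p) (here refl) = [] , H ∷ p , refl , refl , refl
∈verticesFrom⇒end-of-prefix x y (U ∷ p) (there u∈) with ∈verticesFrom⇒end-of-prefix (suc x) (y + 1ℤ) p u∈
... | L , R , refl , refl , refl = U ∷ L , R , refl , ℕP.+-suc (width L) x , refl
∈verticesFrom⇒end-of-prefix x y (D ∷ p) (there u∈) with ∈verticesFrom⇒end-of-prefix (suc x) (y - 1ℤ) p u∈
... | L , R , refl , refl , refl = D ∷ L , R , refl , ℕP.+-suc (width L) x , refl
∈verticesFrom⇒end-of-prefix x y (H ∷ p) (there u∈) with ∈verticesFrom⇒end-of-prefix (suc (suc x)) y p u∈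
... | L , R , refl , refl , refl =
  H ∷ L , R , refl , trans (ℕP.+-suc (width L) (suc x)) (cong suc (ℕP.+-suc (width L) x)) , refl

-- A path through (ℓ, y) is stored centred at (ℓ, y): its part left of ℓ read backwards from
-- (ℓ, y), which is a LeftPart ℓ y, and its part right of ℓ.
LeftPart : ℕ → ℤ → Path → Set
LeftPart ℓ y M = width M ≡ ℓ × endFrom y M ≡ 0ℤ

centre : ℕ → Path → Path × Path
centre ℓ p = Prod.map₁ backwards (cut ℓ p)

uncentre : Path × Path → Path
uncentre (M , R) = backwards M ++ R

uncentre-centre : ∀ ℓ p → uncentre (centre ℓ p) ≡ p
uncentre-centre ℓ p = trans (cong (_++ proj₂ (cut ℓ p)) (backwards-involutive (proj₁ (cut ℓ p)))) (cut-++ ℓ p)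

centre-uncentre : ∀ {ℓ M} R → width M ≡ ℓ → centre ℓ (uncentre (M , R)) ≡ (M , R)
centre-uncentre {M = M} R refl = begin
  Prod.map₁ backwards (cut (width M) (backwards M ++ R))
    ≡⟨ cong (λ w → Prod.map₁ backwards (cut w (backwards M ++ R))) (width-backwards M) ⟨
  Prod.map₁ backwards (cut (width (backwards M)) (backwards M ++ R))
    ≡⟨ cong (Prod.map₁ backwards) (cut-width-++ (backwards M) R) ⟩
  backwards (backwards M) , R
    ≡⟨ cong (_, R) (backwards-involutive M) ⟩
  M , R ∎
  where open ≡-Reasoning

centre-LeftPart : ∀ {ℓ y} p → Contains p ℓ y → LeftPart ℓ y (proj₁ (centre ℓ p))
centre-LeftPart {ℓ} p ℓy∈ with ∈verticesFrom⇒end-of-prefix 0 0ℤ p ℓy∈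
... | L , R , refl , ℓ≡ , refl rewrite trans ℓ≡ (ℕP.+-identityʳ (width L)) | cut-width-++ L R =
  width-backwards L , endFrom-backwards 0ℤ L

module _ {ℓ y M} (left : LeftPart ℓ y M) (R : Path) where

  private
    start-of-R : endFrom 0ℤ (backwards M) ≡ y
    start-of-R = trans (cong (λ v → endFrom v (backwards M)) (sym (proj₂ left))) (endFrom-backwards y M)

    width-backwards-M : width (backwards M) ≡ ℓ
    width-backwards-M = trans (width-backwards M) (proj₁ left)

  width-uncentre : width (uncentre (M , R)) ≡ ℓ ℕ.+ width R
  width-uncentre = trans (width-++ (backwards M) R) (cong (ℕ._+ width R) width-backwards-M)

  endFrom-uncentre : endFrom 0ℤ (uncentre (M , R)) ≡ endFrom y R
  endFrom-uncentre = trans (endFrom-++ 0ℤ (backwards M) R) (cong (λ v → endFrom v R) start-of-R)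

  uncentre-contains : Contains (uncentre (M , R)) ℓ y
  uncentre-contains =
    subst₂ (λ u v → (u , v) ∈ verticesFrom 0 0ℤ (uncentre (M , R)))
           (trans (ℕP.+-identityʳ _) width-backwards-M) start-of-R
           (end-of-prefix∈verticesFrom 0 0ℤ (backwards M) R)

  height-uncentreˡ : ∀ {z} d → d ℕ.+ z ≡ ℓ → height (uncentre (M , R)) z ≡ hgtFrom y M d
  height-uncentreˡ {z} d d+z≡ℓ = begin
    hgtFrom 0ℤ (backwards M ++ R) z         ≡⟨ hgtFrom-++ˡ 0ℤ (backwards M) R z≤ ⟩
    hgtFrom 0ℤ (backwards M) z              ≡⟨ cong (λ v → hgtFrom v (backwards M) z) (proj₂ left) ⟨
    hgtFrom (endFrom y M) (backwards M) z   ≡⟨ hgtFrom-backwards y M z d (trans d+z≡ℓ (sym (proj₁ left))) ⟩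
    hgtFrom y M d                           ∎
    where
    open ≡-Reasoning
    z≤ : z ≤ width (backwards M)
    z≤ = subst (z ≤_) (trans d+z≡ℓ (sym width-backwards-M)) (ℕP.m≤n+m z d)

  height-uncentreʳ : ∀ d → height (uncentre (M , R)) (ℓ ℕ.+ d) ≡ hgtFrom y R d
  height-uncentreʳ d = begin
    hgtFrom 0ℤ (backwards M ++ R) (ℓ ℕ.+ d)                   ≡⟨ cong (λ w → hgtFrom 0ℤ (backwards M ++ R) (w ℕ.+ d)) width-backwards-M ⟨
    hgtFrom 0ℤ (backwards M ++ R) (width (backwards M) ℕ.+ d) ≡⟨ hgtFrom-++ʳ 0ℤ (backwards M) R d ⟩
    hgtFrom (endFrom 0ℤ (backwards M)) R d                    ≡⟨ cong (λ v → hgtFrom v R d) start-of-R ⟩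
    hgtFrom y R d                                             ∎
    where open ≡-Reasoning

width≡0⇒[] : ∀ p → width p ≡ 0 → p ≡ []
width≡0⇒[] []      _  = refl
width≡0⇒[] (U ∷ p) ()
width≡0⇒[] (D ∷ p) ()
width≡0⇒[] (H ∷ p) ()

width⇒∈stepLists : ∀ n p → width p ≡ n → p ∈ stepLists n
width⇒∈stepLists zero          []      refl = here refl
width⇒∈stepLists zero          (U ∷ p) ()
width⇒∈stepLists zero          (D ∷ p) ()
width⇒∈stepLists zero          (H ∷ p) ()
width⇒∈stepLists (suc n)       []      ()
width⇒∈stepLists (suc zero)    (H ∷ p) ()
width⇒∈stepLists (suc zero)    (U ∷ p) e rewrite width≡0⇒[] p (ℕP.suc-injective e) = here refl
width⇒∈stepLists (suc zero)    (D ∷ p) e rewrite width≡0⇒[] p (ℕP.suc-injective e) = there (here refl)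
width⇒∈stepLists (suc (suc n)) (U ∷ p) e =
  ∈-++⁺ˡ (∈-map⁺ (U ∷_) (width⇒∈stepLists (suc n) p (ℕP.suc-injective e)))
width⇒∈stepLists (suc (suc n)) (D ∷ p) e =
  ∈-++⁺ʳ (map (U ∷_) (stepLists (suc n))) (∈-++⁺ˡ (∈-map⁺ (D ∷_) (width⇒∈stepLists (suc n) p (ℕP.suc-injective e))))
width⇒∈stepLists (suc (suc n)) (H ∷ p) e =
  ∈-++⁺ʳ (map (U ∷_) (stepLists (suc n))) (∈-++⁺ʳ (map (D ∷_) (stepLists (suc n)))
    (∈-map⁺ (H ∷_) (width⇒∈stepLists n p (ℕP.suc-injective (ℕP.suc-injective e)))))

∈stepLists⇒width : ∀ n p → p ∈ stepLists n → width p ≡ n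
∈stepLists⇒width zero          p (here refl)         = refl
∈stepLists⇒width (suc zero)    p (here refl)         = refl
∈stepLists⇒width (suc zero)    p (there (here refl)) = refl
∈stepLists⇒width (suc (suc n)) p p∈ with ∈-++⁻ (map (U ∷_) (stepLists (suc n))) p∈
... | inj₁ p∈U with ∈-map⁻ (U ∷_) p∈U
...   | q , q∈ , refl = cong suc (∈stepLists⇒width (suc n) q q∈)
∈stepLists⇒width (suc (suc n)) p p∈ | inj₂ p∈DH with ∈-++⁻ (map (D ∷_) (stepLists (suc n))) p∈DH
... | inj₁ p∈D with ∈-map⁻ (D ∷_) p∈D
...   | q , q∈ , refl = cong suc (∈stepLists⇒width (suc n) q q∈)
∈stepLists⇒width (suc (suc n)) p p∈ | inj₂ p∈DH | inj₂ p∈H with ∈-map⁻ (H ∷_) p∈H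
...   | q , q∈ , refl = cong (suc ∘ suc) (∈stepLists⇒width n q q∈)

map-∷-disjoint : ∀ {s t : Step} → s ≢ t → (ps qs : List Path) → Disjoint (map (s ∷_) ps) (map (t ∷_) qs)
map-∷-disjoint {s} {t} s≢t ps qs (p∈ , q∈) with ∈-map⁻ (s ∷_) p∈ | ∈-map⁻ (t ∷_) q∈
... | _ , _ , refl | _ , _ , eq = s≢t (LP.∷-injectiveˡ eq)

disjoint-++ʳ : ∀ {A : Set} {xs ys zs : List A} → Disjoint xs ys → Disjoint xs zs → Disjoint xs (ys ++ zs)
disjoint-++ʳ {ys = ys} xs#ys xs#zs (x∈xs , x∈ys++zs) with ∈-++⁻ ys x∈ys++zs
... | inj₁ x∈ys = xs#ys (x∈xs , x∈ys)
... | inj₂ x∈zs = xs#zs (x∈xs , x∈zs)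

stepLists-unique : ∀ n → Unique (stepLists n)
stepLists-unique zero          = All.[] ∷ []
stepLists-unique (suc zero)    = ((λ ()) All.∷ All.[]) ∷ All.[] ∷ []
stepLists-unique (suc (suc n)) =
  Unique.++⁺ (ups (suc n))
    (Unique.++⁺ (ups (suc n)) (ups n) (map-∷-disjoint (λ ()) _ _))
    (disjoint-++ʳ {ys = map (D ∷_) (stepLists (suc n))} (map-∷-disjoint (λ ()) _ _) (map-∷-disjoint (λ ()) _ _))
  where
  ups : ∀ m {s} → Unique (map (s ∷_) (stepLists m))
  ups m = Unique.map⁺ LP.∷-injectiveʳ (stepLists-unique m)

length-cartesianProduct : ∀ {A B : Set} (xs : List A) (ys : List B) →
  length (cartesianProduct xs ys) ≡ length xs * length ys
length-cartesianProduct []       ys = refl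
length-cartesianProduct (x ∷ xs) ys =
  trans (LP.length-++ (map (x ,_) ys)) (cong₂ ℕ._+_ (LP.length-map (x ,_) ys) (length-cartesianProduct xs ys))

injective⇒length≤ : ∀ {A B : Set} (xs : List A) (ys : List B) (f : A → B) → Unique xs →
  (∀ {x} → x ∈ xs → f x ∈ ys) → (∀ {x x′} → x ∈ xs → x′ ∈ xs → f x ≡ f x′ → x ≡ x′) →
  length xs ≤ length ys
injective⇒length≤ []       ys f _              _     _   = z≤n
injective⇒length≤ (x ∷ xs) ys f (x∉xs ∷ xs!) maps-to inj with ∈-∃++ (maps-to (here refl))
... | us , vs , refl =
  subst (suc (length xs) ≤_) (sym (LP.length-++-sucʳ us (f x) vs))
        (s≤s (injective⇒length≤ xs (us ++ vs) f xs! maps-to′ (λ x∈ x′∈ → inj (there x∈) (there x′∈))))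
  where
  maps-to′ : ∀ {x′} → x′ ∈ xs → f x′ ∈ us ++ vs
  maps-to′ {x′} x′∈ with ∈-++⁻ us (maps-to (there x′∈))
  ... | inj₁ ∈us         = ∈-++⁺ˡ ∈us
  ... | inj₂ (here fx′≡) = ⊥-elim (All.lookup x∉xs x′∈ (inj (here refl) (there x′∈) (sym fx′≡)))
  ... | inj₂ (there ∈vs) = ∈-++⁺ʳ us ∈vs

-- The walk to the meeting point

record Meeting : Set where
  constructor meeting
  field
    before₁ before₂ after₁ after₂ : Path
open Meeting

both : Step → Step → Meeting → Meeting
both x y (meeting b₁ b₂ a₁ a₂) = meeting (x ∷ b₁) (y ∷ b₂) a₁ a₂

first : Step → Meeting → Meeting
first x (meeting b₁ b₂ a₁ a₂) = meeting (x ∷ b₁) b₂ a₁ a₂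

second : Step → Meeting → Meeting
second y (meeting b₁ b₂ a₁ a₂) = meeting b₁ (y ∷ b₂) a₁ a₂

failed : Meeting
failed = meeting [] [] [] []

levelGap : ℕ → ℕ
levelGap zero    = 2
levelGap (suc t) = suc (suc (levelGap t))

-- Walk along two paths, the first one strictly above the second, until the first common vertex at which
-- the first is exactly 2 above the second.  In meet t both paths are at a vertex and the first is
-- levelGap t above; in meet-H₁ t (meet-H₂ t) the first (second) path is halfway through an H step,
-- the other is at a vertex, and the first is suc (levelGap t) above.
meet    : ℕ → Path → Path → Meeting
meet-H₁ : ℕ → Path → Path → Meeting
meet-H₂ : ℕ → Path → Path → Meeting

meet zero    r       s       = meeting [] [] r s
meet (suc t) (U ∷ r) (U ∷ s) = both U U (meet (suc t) r s)
meet (suc t) (U ∷ r) (D ∷ s) = both U D (meet (suc (suc t)) r s)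
meet (suc t) (D ∷ r) (U ∷ s) = both D U (meet t r s)
meet (suc t) (D ∷ r) (D ∷ s) = both D D (meet (suc t) r s)
meet (suc t) (H ∷ r) (H ∷ s) = both H H (meet (suc t) r s)
meet (suc t) (H ∷ r) (U ∷ s) = both H U (meet-H₁ t r s)
meet (suc t) (H ∷ r) (D ∷ s) = both H D (meet-H₁ (suc t) r s)
meet (suc t) (U ∷ r) (H ∷ s) = both U H (meet-H₂ (suc t) r s)
meet (suc t) (D ∷ r) (H ∷ s) = both D H (meet-H₂ t r s)
meet (suc t) []      _       = failed
meet (suc t) (_ ∷ _) []      = failed

meet-H₁ t r (U ∷ s) = second U (meet t r s)
meet-H₁ t r (D ∷ s) = second D (meet (suc t) r s)
meet-H₁ t r (H ∷ s) = second H (meet-H₂ t r s)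
meet-H₁ t r []      = failed

meet-H₂ t (U ∷ r) s = first U (meet (suc t) r s)
meet-H₂ t (D ∷ r) s = first D (meet t r s)
meet-H₂ t (H ∷ r) s = first H (meet-H₁ t r s)
meet-H₂ t []      s = failed

-- Domain predicates of the walks: Meets t r s holds when meet t r s stops at a genuine meeting
-- point, so that the junk value failed is never returned.
data Meets    : ℕ → Path → Path → Set
data Meets-H₁ : ℕ → Path → Path → Set
data Meets-H₂ : ℕ → Path → Path → Set

data Meets where
  done : ∀ {r s} → Meets zero r s
  UU : ∀ {t r s} → Meets (suc t) r s       → Meets (suc t) (U ∷ r) (U ∷ s)
  UD : ∀ {t r s} → Meets (suc (suc t)) r s → Meets (suc t) (U ∷ r) (D ∷ s)
  DU : ∀ {t r s} → Meets t r s             → Meets (suc t) (D ∷ r) (U ∷ s)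
  DD : ∀ {t r s} → Meets (suc t) r s       → Meets (suc t) (D ∷ r) (D ∷ s)
  HH : ∀ {t r s} → Meets (suc t) r s       → Meets (suc t) (H ∷ r) (H ∷ s)
  HU : ∀ {t r s} → Meets-H₁ t r s          → Meets (suc t) (H ∷ r) (U ∷ s)
  HD : ∀ {t r s} → Meets-H₁ (suc t) r s    → Meets (suc t) (H ∷ r) (D ∷ s)
  UH : ∀ {t r s} → Meets-H₂ (suc t) r s    → Meets (suc t) (U ∷ r) (H ∷ s)
  DH : ∀ {t r s} → Meets-H₂ t r s          → Meets (suc t) (D ∷ r) (H ∷ s)

data Meets-H₁ where
  U₂ : ∀ {t r s} → Meets t r s       → Meets-H₁ t r (U ∷ s)
  D₂ : ∀ {t r s} → Meets (suc t) r s → Meets-H₁ t r (D ∷ s)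
  H₂ : ∀ {t r s} → Meets-H₂ t r s    → Meets-H₁ t r (H ∷ s)

data Meets-H₂ where
  U₁ : ∀ {t r s} → Meets (suc t) r s → Meets-H₂ t (U ∷ r) s
  D₁ : ∀ {t r s} → Meets t r s       → Meets-H₂ t (D ∷ r) s
  H₁ : ∀ {t r s} → Meets-H₁ t r s    → Meets-H₂ t (H ∷ r) s

-- A record rather than an equation, so that n, a and c can be inferred.
record Above (n : ℕ) (a c : ℤ) : Set where
  constructor above
  field a≡c+n : a ≡ c + + n

up₁ : ∀ {n a c} → Above n a c → Above (suc n) (a + 1ℤ) c
up₁ {n} {c = c} (above refl) = above (identity c (+ n))
  where
  identity : ∀ (c x : ℤ) → (c + x) + 1ℤ ≡ c + (1ℤ + x)
  identity = solve-∀

down₁ : ∀ {n a c} → Above (suc n) a c → Above n (a - 1ℤ) c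
down₁ {n} {c = c} (above refl) = above (identity c (+ n))
  where
  identity : ∀ (c x : ℤ) → (c + (1ℤ + x)) - 1ℤ ≡ c + x
  identity = solve-∀

up₂ : ∀ {n a c} → Above (suc n) a c → Above n a (c + 1ℤ)
up₂ {n} {c = c} (above refl) = above (identity c (+ n))
  where
  identity : ∀ (c x : ℤ) → c + (1ℤ + x) ≡ (c + 1ℤ) + x
  identity = solve-∀

down₂ : ∀ {n a c} → Above n a c → Above (suc n) a (c - 1ℤ)
down₂ {n} {c = c} (above refl) = above (identity c (+ n))
  where
  identity : ∀ (c x : ℤ) → c + x ≡ (c - 1ℤ) + (1ℤ + x)
  identity = solve-∀

up-up : ∀ {n a c} → Above n a c → Above n (a + 1ℤ) (c + 1ℤ)
up-up = up₂ ∘ up₁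

down-down : ∀ {n a c} → Above n a c → Above n (a - 1ℤ) (c - 1ℤ)
down-down = down₁ ∘ down₂

Above-suc⇒≢ : ∀ {n a c} → Above (suc n) a c → a ≢ c
Above-suc⇒≢ {n} {c = c} (above refl) e with trans (sym (identity c (+ suc n))) (trans (cong (_- c) e) (ℤP.+-inverseʳ c))
  where
  identity : ∀ (c x : ℤ) → (c + x) - c ≡ x
  identity = solve-∀
... | ()

meets    : ∀ t r s {a c} → width r ≡ width s → Above (levelGap t) a c → endFrom a r ≡ endFrom c s → Meets t r s
meets-H₁ : ∀ t r s {a c} → suc (width r) ≡ width s → Above (suc (levelGap t)) a c → endFrom a r ≡ endFrom c s → Meets-H₁ t r s
meets-H₂ : ∀ t r s {a c} → width r ≡ suc (width s) → Above (suc (levelGap t)) a c → endFrom a r ≡ endFrom c s → Meets-H₂ t r s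

meets zero    r       s       w g e = done
meets (suc t) []      []      w g e = ⊥-elim (Above-suc⇒≢ g e)
meets (suc t) []      (U ∷ s) () g e
meets (suc t) []      (D ∷ s) () g e
meets (suc t) []      (H ∷ s) () g e
meets (suc t) (U ∷ r) []      () g e
meets (suc t) (D ∷ r) []      () g e
meets (suc t) (H ∷ r) []      () g e
meets (suc t) (U ∷ r) (U ∷ s) w g e = UU (meets (suc t) r s (ℕP.suc-injective w) (up-up g) e)
meets (suc t) (U ∷ r) (D ∷ s) w g e = UD (meets (suc (suc t)) r s (ℕP.suc-injective w) (down₂ (up₁ g)) e)
meets (suc t) (D ∷ r) (U ∷ s) w g e = DU (meets t r s (ℕP.suc-injective w) (up₂ (down₁ g)) e)
meets (suc t) (D ∷ r) (D ∷ s) w g e = DD (meets (suc t) r s (ℕP.suc-injective w) (down-down g) e)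
meets (suc t) (H ∷ r) (H ∷ s) w g e = HH (meets (suc t) r s (ℕP.suc-injective (ℕP.suc-injective w)) g e)
meets (suc t) (H ∷ r) (U ∷ s) w g e = HU (meets-H₁ t r s (ℕP.suc-injective w) (up₂ g) e)
meets (suc t) (H ∷ r) (D ∷ s) w g e = HD (meets-H₁ (suc t) r s (ℕP.suc-injective w) (down₂ g) e)
meets (suc t) (U ∷ r) (H ∷ s) w g e = UH (meets-H₂ (suc t) r s (ℕP.suc-injective w) (up₁ g) e)
meets (suc t) (D ∷ r) (H ∷ s) w g e = DH (meets-H₂ t r s (ℕP.suc-injective w) (down₁ g) e)

meets-H₁ t r []      () g e
meets-H₁ t r (U ∷ s) w g e = U₂ (meets t r s (ℕP.suc-injective w) (up₂ g) e)
meets-H₁ t r (D ∷ s) w g e = D₂ (meets (suc t) r s (ℕP.suc-injective w) (down₂ g) e)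
meets-H₁ t r (H ∷ s) w g e = H₂ (meets-H₂ t r s (ℕP.suc-injective w) g e)

meets-H₂ t []      s () g e
meets-H₂ t (U ∷ r) s w g e = U₁ (meets (suc t) r s (ℕP.suc-injective w) (up₁ g) e)
meets-H₂ t (D ∷ r) s w g e = D₁ (meets t r s (ℕP.suc-injective w) (down₁ g) e)
meets-H₂ t (H ∷ r) s w g e = H₁ (meets-H₁ t r s (ℕP.suc-injective w) g e)

record Splits (r s : Path) (q : Meeting) : Set where
  constructor splits
  field
    r≡ : r ≡ before₁ q ++ after₁ q
    s≡ : s ≡ before₂ q ++ after₂ q

both-splits : ∀ {r s q} x y → Splits r s q → Splits (x ∷ r) (y ∷ s) (both x y q)
both-splits x y (splits refl refl) = splits refl refl

first-splits : ∀ {r s q} x → Splits r s q → Splits (x ∷ r) s (first x q)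
first-splits x (splits refl refl) = splits refl refl

second-splits : ∀ {r s q} y → Splits r s q → Splits r (y ∷ s) (second y q)
second-splits y (splits refl refl) = splits refl refl

meet-splits    : ∀ {t r s} → Meets t r s    → Splits r s (meet t r s)
meet-H₁-splits : ∀ {t r s} → Meets-H₁ t r s → Splits r s (meet-H₁ t r s)
meet-H₂-splits : ∀ {t r s} → Meets-H₂ t r s → Splits r s (meet-H₂ t r s)

meet-splits done   = splits refl refl
meet-splits (UU m) = both-splits U U (meet-splits m)
meet-splits (UD m) = both-splits U D (meet-splits m)
meet-splits (DU m) = both-splits D U (meet-splits m)
meet-splits (DD m) = both-splits D D (meet-splits m)
meet-splits (HH m) = both-splits H H (meet-splits m)
meet-splits (HU m) = both-splits H U (meet-H₁-splits m)
meet-splits (HD m) = both-splits H D (meet-H₁-splits m)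
meet-splits (UH m) = both-splits U H (meet-H₂-splits m)
meet-splits (DH m) = both-splits D H (meet-H₂-splits m)

meet-H₁-splits (U₂ m) = second-splits U (meet-splits m)
meet-H₁-splits (D₂ m) = second-splits D (meet-splits m)
meet-H₁-splits (H₂ m) = second-splits H (meet-H₂-splits m)

meet-H₂-splits (U₁ m) = first-splits U (meet-splits m)
meet-H₂-splits (D₁ m) = first-splits D (meet-splits m)
meet-H₂-splits (H₁ m) = first-splits H (meet-H₁-splits m)

meet-width    : ∀ {t r s} → Meets t r s    → width (before₁ (meet t r s)) ≡ width (before₂ (meet t r s))
meet-H₁-width : ∀ {t r s} → Meets-H₁ t r s → suc (width (before₁ (meet-H₁ t r s))) ≡ width (before₂ (meet-H₁ t r s))
meet-H₂-width : ∀ {t r s} → Meets-H₂ t r s → width (before₁ (meet-H₂ t r s)) ≡ suc (width (before₂ (meet-H₂ t r s)))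

meet-width done   = refl
meet-width (UU m) = cong suc (meet-width m)
meet-width (UD m) = cong suc (meet-width m)
meet-width (DU m) = cong suc (meet-width m)
meet-width (DD m) = cong suc (meet-width m)
meet-width (HH m) = cong (suc ∘ suc) (meet-width m)
meet-width (HU m) = cong suc (meet-H₁-width m)
meet-width (HD m) = cong suc (meet-H₁-width m)
meet-width (UH m) = cong suc (meet-H₂-width m)
meet-width (DH m) = cong suc (meet-H₂-width m)

meet-H₁-width (U₂ m) = cong suc (meet-width m)
meet-H₁-width (D₂ m) = cong suc (meet-width m)
meet-H₁-width (H₂ m) = cong suc (meet-H₂-width m)

meet-H₂-width (U₁ m) = cong suc (meet-width m)
meet-H₂-width (D₁ m) = cong suc (meet-width m)
meet-H₂-width (H₁ m) = cong suc (meet-H₁-width m)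

Restarts : (Path → Path → Meeting) → Meeting → Set
Restarts walk q = ∀ r′ s′ → walk (before₁ q ++ r′) (before₂ q ++ s′) ≡ record q { after₁ = r′ ; after₂ = s′ }

meet-restarts    : ∀ {t r s} → Meets t r s    → Restarts (meet t) (meet t r s)
meet-H₁-restarts : ∀ {t r s} → Meets-H₁ t r s → Restarts (meet-H₁ t) (meet-H₁ t r s)
meet-H₂-restarts : ∀ {t r s} → Meets-H₂ t r s → Restarts (meet-H₂ t) (meet-H₂ t r s)

meet-restarts done   r′ s′ = refl
meet-restarts (UU m) r′ s′ = cong (both U U) (meet-restarts m r′ s′)
meet-restarts (UD m) r′ s′ = cong (both U D) (meet-restarts m r′ s′)
meet-restarts (DU m) r′ s′ = cong (both D U) (meet-restarts m r′ s′)
meet-restarts (DD m) r′ s′ = cong (both D D) (meet-restarts m r′ s′)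
meet-restarts (HH m) r′ s′ = cong (both H H) (meet-restarts m r′ s′)
meet-restarts (HU m) r′ s′ = cong (both H U) (meet-H₁-restarts m r′ s′)
meet-restarts (HD m) r′ s′ = cong (both H D) (meet-H₁-restarts m r′ s′)
meet-restarts (UH m) r′ s′ = cong (both U H) (meet-H₂-restarts m r′ s′)
meet-restarts (DH m) r′ s′ = cong (both D H) (meet-H₂-restarts m r′ s′)

meet-H₁-restarts (U₂ m) r′ s′ = cong (second U) (meet-restarts m r′ s′)
meet-H₁-restarts (D₂ m) r′ s′ = cong (second D) (meet-restarts m r′ s′)
meet-H₁-restarts (H₂ m) r′ s′ = cong (second H) (meet-H₂-restarts m r′ s′)

meet-H₂-restarts (U₁ m) r′ s′ = cong (first U) (meet-restarts m r′ s′)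
meet-H₂-restarts (D₁ m) r′ s′ = cong (first D) (meet-restarts m r′ s′)
meet-H₂-restarts (H₁ m) r′ s′ = cong (first H) (meet-H₁-restarts m r′ s′)

meet-endFrom    : ∀ {t r s a c} → Meets t r s → Above (levelGap t) a c →
  endFrom a (before₁ (meet t r s)) ≡ endFrom c (before₂ (meet t r s)) + + 2
meet-H₁-endFrom : ∀ {t r s a c} → Meets-H₁ t r s → Above (suc (levelGap t)) a c →
  endFrom a (before₁ (meet-H₁ t r s)) ≡ endFrom c (before₂ (meet-H₁ t r s)) + + 2
meet-H₂-endFrom : ∀ {t r s a c} → Meets-H₂ t r s → Above (suc (levelGap t)) a c →
  endFrom a (before₁ (meet-H₂ t r s)) ≡ endFrom c (before₂ (meet-H₂ t r s)) + + 2

meet-endFrom done   g = Above.a≡c+n g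
meet-endFrom (UU m) g = meet-endFrom m (up-up g)
meet-endFrom (UD m) g = meet-endFrom m (down₂ (up₁ g))
meet-endFrom (DU m) g = meet-endFrom m (up₂ (down₁ g))
meet-endFrom (DD m) g = meet-endFrom m (down-down g)
meet-endFrom (HH m) g = meet-endFrom m g
meet-endFrom (HU m) g = meet-H₁-endFrom m (up₂ g)
meet-endFrom (HD m) g = meet-H₁-endFrom m (down₂ g)
meet-endFrom (UH m) g = meet-H₂-endFrom m (up₁ g)
meet-endFrom (DH m) g = meet-H₂-endFrom m (down₁ g)

meet-H₁-endFrom (U₂ m) g = meet-endFrom m (up₂ g)
meet-H₁-endFrom (D₂ m) g = meet-endFrom m (down₂ g)
meet-H₁-endFrom (H₂ m) g = meet-H₂-endFrom m g

meet-H₂-endFrom (U₁ m) g = meet-endFrom m (up₁ g)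
meet-H₂-endFrom (D₁ m) g = meet-endFrom m (down₁ g)
meet-H₂-endFrom (H₁ m) g = meet-H₁-endFrom m g

Above⇒+2≤ : ∀ {n a c} → 2 ℕ.≤ n → Above n a c → c + + 2 ℤ.≤ a
Above⇒+2≤ {c = c} 2≤n (above refl) = ℤP.+-monoʳ-≤ c (ℤ.+≤+ 2≤n)

2≤levelGap : ∀ t → 2 ℕ.≤ levelGap t
2≤levelGap zero    = ℕP.≤-refl
2≤levelGap (suc t) = s≤s (s≤s z≤n)

level-below : ∀ t {a c} → Above (levelGap t) a c → c + + 2 ℤ.≤ a
level-below t = Above⇒+2≤ (2≤levelGap t)

mid-below : ∀ t {a c} → Above (suc (levelGap t)) a c → c + + 2 ℤ.≤ a
mid-below t = Above⇒+2≤ (ℕP.m≤n⇒m≤1+n (2≤levelGap t))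

meet-below    : ∀ {t r s a c} → Meets t r s → Above (levelGap t) a c →
  ∀ z → z ≤ width (before₁ (meet t r s)) → hgtFrom c s z + + 2 ℤ.≤ hgtFrom a r z
meet-H₁-below : ∀ {t r s a c} → Meets-H₁ t r s → Above (suc (levelGap t)) a c →
  ∀ z → z ≤ width (before₂ (meet-H₁ t r s)) → hgtFrom c s z + + 2 ℤ.≤ hgtFrom a (H ∷ r) (suc z)
meet-H₂-below : ∀ {t r s a c} → Meets-H₂ t r s → Above (suc (levelGap t)) a c →
  ∀ z → z ≤ width (before₁ (meet-H₂ t r s)) → hgtFrom c (H ∷ s) (suc z) + + 2 ℤ.≤ hgtFrom a r z

meet-below {r = r} {s} {a} {c} done g zero z≤n
  rewrite hgtFrom-zero c s | hgtFrom-zero a r = level-below 0 g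
meet-below {suc t} (UU m) g zero          _                = level-below (suc t) g
meet-below {suc t} (UU m) g (suc z)       (s≤s z≤)         = meet-below m (up-up g) z z≤
meet-below {suc t} (UD m) g zero          _                = level-below (suc t) g
meet-below {suc t} (UD m) g (suc z)       (s≤s z≤)         = meet-below m (down₂ (up₁ g)) z z≤
meet-below {suc t} (DU m) g zero          _                = level-below (suc t) g
meet-below {suc t} (DU m) g (suc z)       (s≤s z≤)         = meet-below m (up₂ (down₁ g)) z z≤
meet-below {suc t} (DD m) g zero          _                = level-below (suc t) g
meet-below {suc t} (DD m) g (suc z)       (s≤s z≤)         = meet-below m (down-down g) z z≤
meet-below {suc t} (HH m) g zero          _                = level-below (suc t) g
meet-below {suc t} (HH m) g (suc zero)    _                = level-below (suc t) g
meet-below {suc t} (HH m) g (suc (suc z)) (s≤s (s≤s z≤))   = meet-below m g z z≤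
meet-below {suc t} (HU m) g zero          _                = level-below (suc t) g
meet-below {suc t} (HU m) g (suc z)       (s≤s z≤)         = meet-H₁-below m (up₂ g) z (subst (z ≤_) (meet-H₁-width m) z≤)
meet-below {suc t} (HD m) g zero          _                = level-below (suc t) g
meet-below {suc t} (HD m) g (suc z)       (s≤s z≤)         = meet-H₁-below m (down₂ g) z (subst (z ≤_) (meet-H₁-width m) z≤)
meet-below {suc t} (UH m) g zero          _                = level-below (suc t) g
meet-below {suc t} (UH m) g (suc z)       (s≤s z≤)         = meet-H₂-below m (up₁ g) z z≤
meet-below {suc t} (DH m) g zero          _                = level-below (suc t) g
meet-below {suc t} (DH m) g (suc z)       (s≤s z≤)         = meet-H₂-below m (down₁ g) z z≤

meet-H₁-below {t} (U₂ m) g zero    _        = mid-below t g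
meet-H₁-below {t} (U₂ m) g (suc z) (s≤s z≤) = meet-below m (up₂ g) z (subst (z ≤_) (sym (meet-width m)) z≤)
meet-H₁-below {t} (D₂ m) g zero    _        = mid-below t g
meet-H₁-below {t} (D₂ m) g (suc z) (s≤s z≤) = meet-below m (down₂ g) z (subst (z ≤_) (sym (meet-width m)) z≤)
meet-H₁-below {t} (H₂ m) g zero    _        = mid-below t g
meet-H₁-below {t} (H₂ m) g (suc z) (s≤s z≤) = meet-H₂-below m g z (subst (z ≤_) (sym (meet-H₂-width m)) z≤)

meet-H₂-below {t} (U₁ m) g zero    _        = mid-below t g
meet-H₂-below {t} (U₁ m) g (suc z) (s≤s z≤) = meet-below m (up₁ g) z z≤
meet-H₂-below {t} (D₁ m) g zero    _        = mid-below t g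
meet-H₂-below {t} (D₁ m) g (suc z) (s≤s z≤) = meet-below m (down₁ g) z z≤
meet-H₂-below {t} (H₁ m) g zero    _        = mid-below t g
meet-H₂-below {t} (H₁ m) g (suc z) (s≤s z≤) = meet-H₁-below m g z (subst (z ≤_) (meet-H₁-width m) z≤)

-- Exchanging the tails at the meeting point

record Crossing (k : ℤ) (q : Meeting) : Set where
  field
    widths : width (before₁ q) ≡ width (before₂ q)
    ends   : endFrom (k + + 2) (before₁ q) ≡ endFrom (k - + 2) (before₂ q) + + 2
    below  : ∀ z → z ≤ width (before₁ q) →
             hgtFrom (k - + 2) (before₂ q ++ after₂ q) z + + 2 ℤ.≤ hgtFrom (k + + 2) (before₁ q ++ after₁ q) z

[k-2]+2≡k : ∀ k → (k - + 2) + + 2 ≡ k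
[k-2]+2≡k = solve-∀

k+2-Above-k-2 : ∀ k → Above 4 (k + + 2) (k - + 2)
k+2-Above-k-2 k = above (identity k)
  where
  identity : ∀ k → k + + 2 ≡ (k - + 2) + + 4
  identity = solve-∀

meet-crossing : ∀ {r s} k → Meets 1 r s → Crossing k (meet 1 r s)
meet-crossing k m = record
  { widths = meet-width m
  ; ends   = meet-endFrom m (k+2-Above-k-2 k)
  ; below  = λ z z≤ → subst₂ (λ u v → hgtFrom (k - + 2) v z + + 2 ℤ.≤ hgtFrom (k + + 2) u z)
                             (Splits.r≡ (meet-splits m)) (Splits.s≡ (meet-splits m))
                             (meet-below m (k+2-Above-k-2 k) z z≤)
  }

Between : ℤ → ℤ → ℤ → Set
Between P Q x = P ℤ.⊓ Q ℤ.≤ x × x ℤ.≤ P ℤ.⊔ Q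

between-exchanged : ∀ P Q → Between P Q Q × Between P Q P
between-exchanged P Q = (ℤP.i⊓j≤j P Q , ℤP.i≤j⊔i P Q) , (ℤP.i⊓j≤i P Q , ℤP.i≤i⊔j P Q)

+-cancelʳ-≤ : ∀ {x y} k → x + k ℤ.≤ y + k → x ℤ.≤ y
+-cancelʳ-≤ {x} {y} k x+k≤y+k = subst₂ ℤ._≤_ (identity x k) (identity y k) (ℤP.+-monoˡ-≤ (ℤ.- k) x+k≤y+k)
  where
  identity : ∀ x k → (x + k) - k ≡ x
  identity = solve-∀

between-squeezed : ∀ {P′ Q} → Q + + 2 ℤ.≤ P′ + + 2 → Between (P′ + + 2) Q P′ × Between (P′ + + 2) Q (Q + + 2)
between-squeezed {P′} {Q} Q+2≤P′+2 =
  (ℤP.≤-trans (ℤP.i⊓j≤j _ Q) (+-cancelʳ-≤ (+ 2) Q+2≤P′+2) , ℤP.≤-trans (ℤP.i≤i+j P′ (+ 2)) (ℤP.i≤i⊔j _ Q)) ,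
  (ℤP.≤-trans (ℤP.i⊓j≤j _ Q) (ℤP.i≤i+j Q (+ 2))          , ℤP.≤-trans Q+2≤P′+2 (ℤP.i≤i⊔j _ Q))

between-bounded : ∀ {lo hi P Q x} → lo ℤ.≤ P × P ℤ.≤ hi → lo ℤ.≤ Q × Q ℤ.≤ hi → Between P Q x → lo ℤ.≤ x × x ℤ.≤ hi
between-bounded (lo≤P , P≤hi) (lo≤Q , Q≤hi) (P⊓Q≤x , x≤P⊔Q) =
  ℤP.≤-trans (ℤP.⊓-glb lo≤P lo≤Q) P⊓Q≤x , ℤP.≤-trans x≤P⊔Q (ℤP.⊔-lub P≤hi Q≤hi)

module _ {k q} (crossing : Crossing k q) where

  open Crossing crossing
  private
    b₁ = before₁ q
    b₂ = before₂ q
    a₁ = after₁ q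
    a₂ = after₂ q

  crossing-endFrom₁ : endFrom k b₁ ≡ endFrom (k - + 2) b₂
  crossing-endFrom₁ = ∙-cancelʳ (+ 2) _ _ (trans (sym (endFrom-+ k (+ 2) b₁)) ends)

  crossing-endFrom₂ : endFrom k b₂ ≡ endFrom (k + + 2) b₁
  crossing-endFrom₂ = begin
    endFrom k b₂                    ≡⟨ cong (λ v → endFrom v b₂) ([k-2]+2≡k k) ⟨
    endFrom ((k - + 2) + + 2) b₂    ≡⟨ endFrom-+ (k - + 2) (+ 2) b₂ ⟩
    endFrom (k - + 2) b₂ + + 2      ≡⟨ ends ⟨
    endFrom (k + + 2) b₁            ∎
    where open ≡-Reasoning

  SwappedBetween : ℕ → Set
  SwappedBetween z =
    Between (hgtFrom (k + + 2) (b₁ ++ a₁) z) (hgtFrom (k - + 2) (b₂ ++ a₂) z) (hgtFrom k (b₁ ++ a₂) z) ×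
    Between (hgtFrom (k + + 2) (b₁ ++ a₁) z) (hgtFrom (k - + 2) (b₂ ++ a₂) z) (hgtFrom k (b₂ ++ a₁) z)

  crossing-between-before : ∀ z → z ≤ width b₁ → SwappedBetween z
  crossing-between-before z z≤ =
    subst₂ (λ P Q′ → Between P Q (hgtFrom k (b₁ ++ a₂) z) × Between P Q Q′) P≡ Q′≡
           (between-squeezed (subst₂ ℤ._≤_ refl (sym P≡) (below z z≤)))
    where
    Q = hgtFrom (k - + 2) (b₂ ++ a₂) z
    P≡ : hgtFrom k (b₁ ++ a₂) z + + 2 ≡ hgtFrom (k + + 2) (b₁ ++ a₁) z
    P≡ = trans (sym (hgtFrom-+ k (+ 2) (b₁ ++ a₂) z)) (hgtFrom-++-prefix (k + + 2) b₁ a₂ a₁ z≤)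
    Q′≡ : Q + + 2 ≡ hgtFrom k (b₂ ++ a₁) z
    Q′≡ = begin
      Q + + 2                                  ≡⟨ hgtFrom-+ (k - + 2) (+ 2) (b₂ ++ a₂) z ⟨
      hgtFrom ((k - + 2) + + 2) (b₂ ++ a₂) z   ≡⟨ cong (λ v → hgtFrom v (b₂ ++ a₂) z) ([k-2]+2≡k k) ⟩
      hgtFrom k (b₂ ++ a₂) z                   ≡⟨ hgtFrom-++-prefix k b₂ a₂ a₁ (subst (z ≤_) widths z≤) ⟩
      hgtFrom k (b₂ ++ a₁) z                   ∎
      where open ≡-Reasoning

  crossing-between-after : ∀ z → width b₁ ≤ z → SwappedBetween z
  crossing-between-after z b₁≤z =
    subst₂ (λ P′ Q′ → Between P Q P′ × Between P Q Q′) (sym P′≡) (sym Q′≡) (between-exchanged P Q)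
    where
    d = z ℕ.∸ width b₁
    z≡₁ : width b₁ ℕ.+ d ≡ z
    z≡₁ = ℕP.m+[n∸m]≡n b₁≤z
    z≡₂ : width b₂ ℕ.+ d ≡ z
    z≡₂ = trans (cong (ℕ._+ d) (sym widths)) z≡₁
    P = hgtFrom (k + + 2) (b₁ ++ a₁) z
    Q = hgtFrom (k - + 2) (b₂ ++ a₂) z
    P′≡ : hgtFrom k (b₁ ++ a₂) z ≡ Q
    P′≡ = subst₂ (λ u v → hgtFrom k (b₁ ++ a₂) u ≡ hgtFrom (k - + 2) (b₂ ++ a₂) v) z≡₁ z≡₂
                 (hgtFrom-++-suffix a₂ d widths crossing-endFrom₁)
    Q′≡ : hgtFrom k (b₂ ++ a₁) z ≡ P
    Q′≡ = subst₂ (λ u v → hgtFrom k (b₂ ++ a₁) u ≡ hgtFrom (k + + 2) (b₁ ++ a₁) v) z≡₂ z≡₁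
                 (hgtFrom-++-suffix a₁ d (sym widths) crossing-endFrom₂)

  crossing-between : ∀ z → SwappedBetween z
  crossing-between z = [ crossing-between-before z , crossing-between-after z ]′ (ℕP.≤-total z (width b₁))

swap : Path → Path → Path × Path
swap r s = before₁ q ++ after₂ q , before₂ q ++ after₁ q
  where q = meet 1 r s

module _ {r s} (m : Meets 1 r s) where

  private
    q  = meet 1 r s
    b₁ = before₁ q
    b₂ = before₂ q
    a₁ = after₁ q
    a₂ = after₂ q
    r≡ : r ≡ b₁ ++ a₁
    r≡ = Splits.r≡ (meet-splits m)
    s≡ : s ≡ b₂ ++ a₂
    s≡ = Splits.s≡ (meet-splits m)

  swap-involutive : Prod.uncurry swap (swap r s) ≡ (r , s)
  swap-involutive = begin
    swap (b₁ ++ a₂) (b₂ ++ a₁)   ≡⟨ cong (λ q′ → before₁ q′ ++ after₂ q′ , before₂ q′ ++ after₁ q′) (meet-restarts m a₂ a₁) ⟩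
    (b₁ ++ a₁ , b₂ ++ a₂)        ≡⟨ cong₂ _,_ r≡ s≡ ⟨
    (r , s)                      ∎
    where open ≡-Reasoning

  swap-width : width (proj₁ (swap r s)) ≡ width s × width (proj₂ (swap r s)) ≡ width r
  swap-width = trans (width-++-cong b₁ b₂ a₂ (meet-width m)) (cong width (sym s≡)) ,
               trans (width-++-cong b₂ b₁ a₁ (sym (meet-width m))) (cong width (sym r≡))

  swap-endFrom : ∀ k → endFrom k (proj₁ (swap r s)) ≡ endFrom (k - + 2) s × endFrom k (proj₂ (swap r s)) ≡ endFrom (k + + 2) r
  swap-endFrom k =
    trans (endFrom-++-cong k (k - + 2) b₁ b₂ a₂ (crossing-endFrom₁ crossing)) (cong (endFrom (k - + 2)) (sym s≡)) ,
    trans (endFrom-++-cong k (k + + 2) b₂ b₁ a₁ (crossing-endFrom₂ crossing)) (cong (endFrom (k + + 2)) (sym r≡))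
    where crossing = meet-crossing k m

  swap-between : ∀ k z →
    Between (hgtFrom (k + + 2) r z) (hgtFrom (k - + 2) s z) (hgtFrom k (proj₁ (swap r s)) z) ×
    Between (hgtFrom (k + + 2) r z) (hgtFrom (k - + 2) s z) (hgtFrom k (proj₂ (swap r s)) z)
  swap-between k z = subst₂ (λ u v → Between (hgtFrom (k + + 2) u z) (hgtFrom (k - + 2) v z) (hgtFrom k (b₁ ++ a₂) z) ×
                                     Between (hgtFrom (k + + 2) u z) (hgtFrom (k - + 2) v z) (hgtFrom k (b₂ ++ a₁) z))
                            (sym r≡) (sym s≡) (crossing-between (meet-crossing k m) z)

-- The switching map

Between-resp : ∀ {P P′ Q Q′ x x′} → P ≡ P′ → Q ≡ Q′ → x ≡ x′ → Between P′ Q′ x′ → Between P Q x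
Between-resp refl refl refl b = b

uncentre-between : ∀ {ℓ y₁ y₂ y M₁ M₂ M} R₁ R₂ R → LeftPart ℓ y₁ M₁ → LeftPart ℓ y₂ M₂ → LeftPart ℓ y M →
  (∀ d → Between (hgtFrom y₁ M₁ d) (hgtFrom y₂ M₂ d) (hgtFrom y M d)) →
  (∀ d → Between (hgtFrom y₁ R₁ d) (hgtFrom y₂ R₂ d) (hgtFrom y R d)) →
  ∀ z → Between (height (uncentre (M₁ , R₁)) z) (height (uncentre (M₂ , R₂)) z) (height (uncentre (M , R)) z)
uncentre-between {ℓ} {M₁ = M₁} {M₂} {M} R₁ R₂ R l₁ l₂ l left right z with ℕP.≤-total z ℓ
... | inj₁ z≤ℓ = Between-resp (height-uncentreˡ l₁ R₁ d d+z≡ℓ) (height-uncentreˡ l₂ R₂ d d+z≡ℓ) (height-uncentreˡ l R d d+z≡ℓ) (left d)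
  where
  d = ℓ ℕ.∸ z
  d+z≡ℓ : d ℕ.+ z ≡ ℓ
  d+z≡ℓ = ℕP.m∸n+n≡m z≤ℓ
... | inj₂ ℓ≤z = subst (λ z → Between (height (uncentre (M₁ , R₁)) z) (height (uncentre (M₂ , R₂)) z) (height (uncentre (M , R)) z))
                       (ℕP.m+[n∸m]≡n ℓ≤z)
                       (Between-resp (height-uncentreʳ l₁ R₁ d) (height-uncentreʳ l₂ R₂ d) (height-uncentreʳ l R d) (right d))
  where d = z ℕ.∸ ℓ

recombine : Path × Path → Path × Path → Path × Path
recombine (M₁ , M₂) (R₁ , R₂) = uncentre (M₁ , R₁) , uncentre (M₂ , R₂)

switch : ℕ → Path × Path → Path × Path
switch ℓ (p , q) = recombine (swap (proj₁ (centre ℓ p)) (proj₁ (centre ℓ q))) (swap (proj₂ (centre ℓ p)) (proj₂ (centre ℓ q)))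

module Switched (ℓ : ℕ) (k : ℤ) (p q : Path) (p-through : Contains p ℓ (k + + 2)) (q-through : Contains q ℓ (k - + 2))
                (same-width : width p ≡ width q) (same-end : endFrom 0ℤ p ≡ endFrom 0ℤ q) where

  private
    M₁ = proj₁ (centre ℓ p)
    R₁ = proj₂ (centre ℓ p)
    M₂ = proj₁ (centre ℓ q)
    R₂ = proj₂ (centre ℓ q)
    left₁ : LeftPart ℓ (k + + 2) M₁
    left₁ = centre-LeftPart p p-through
    left₂ : LeftPart ℓ (k - + 2) M₂
    left₂ = centre-LeftPart q q-through

    meets-left : Meets 1 M₁ M₂
    meets-left = meets 1 M₁ M₂ (trans (proj₁ left₁) (sym (proj₁ left₂))) (k+2-Above-k-2 k) (trans (proj₂ left₁) (sym (proj₂ left₂)))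

    meets-right : Meets 1 R₁ R₂
    meets-right = meets 1 R₁ R₂ (ℕP.+-cancelˡ-≡ ℓ _ _ widths) (k+2-Above-k-2 k) ends
      where
      widths : ℓ ℕ.+ width R₁ ≡ ℓ ℕ.+ width R₂
      widths = trans (sym (width-uncentre left₁ R₁))
                     (trans (cong width (uncentre-centre ℓ p)) (trans same-width
                            (trans (cong width (sym (uncentre-centre ℓ q))) (width-uncentre left₂ R₂))))
      ends : endFrom (k + + 2) R₁ ≡ endFrom (k - + 2) R₂
      ends = trans (sym (endFrom-uncentre left₁ R₁))
                   (trans (cong (endFrom 0ℤ) (uncentre-centre ℓ p)) (trans same-end
                          (trans (cong (endFrom 0ℤ) (sym (uncentre-centre ℓ q))) (endFrom-uncentre left₂ R₂))))

    M₁′ = proj₁ (swap M₁ M₂)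
    M₂′ = proj₂ (swap M₁ M₂)
    R₁′ = proj₁ (swap R₁ R₂)
    R₂′ = proj₂ (swap R₁ R₂)

    left₁′ : LeftPart ℓ k M₁′
    left₁′ = trans (proj₁ (swap-width meets-left)) (proj₁ left₂) , trans (proj₁ (swap-endFrom meets-left k)) (proj₂ left₂)
    left₂′ : LeftPart ℓ k M₂′
    left₂′ = trans (proj₂ (swap-width meets-left)) (proj₁ left₁) , trans (proj₂ (swap-endFrom meets-left k)) (proj₂ left₁)

    p≡ : uncentre (M₁ , R₁) ≡ p
    p≡ = uncentre-centre ℓ p
    q≡ : uncentre (M₂ , R₂) ≡ q
    q≡ = uncentre-centre ℓ q

    width-uncentre-cong : ∀ {y y′ M M′} R R′ → LeftPart ℓ y M → LeftPart ℓ y′ M′ → width R ≡ width R′ →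
      width (uncentre (M , R)) ≡ width (uncentre (M′ , R′))
    width-uncentre-cong R R′ l l′ w≡ = trans (width-uncentre l R) (trans (cong (ℓ ℕ.+_) w≡) (sym (width-uncentre l′ R′)))

    endFrom-uncentre-cong : ∀ {y y′ M M′} R R′ → LeftPart ℓ y M → LeftPart ℓ y′ M′ → endFrom y R ≡ endFrom y′ R′ →
      endFrom 0ℤ (uncentre (M , R)) ≡ endFrom 0ℤ (uncentre (M′ , R′))
    endFrom-uncentre-cong R R′ l l′ e≡ = trans (endFrom-uncentre l R) (trans e≡ (sym (endFrom-uncentre l′ R′)))

  switch-width : width (proj₁ (switch ℓ (p , q))) ≡ width q × width (proj₂ (switch ℓ (p , q))) ≡ width p
  switch-width = trans (width-uncentre-cong R₁′ R₂ left₁′ left₂ (proj₁ (swap-width meets-right))) (cong width q≡) ,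
                 trans (width-uncentre-cong R₂′ R₁ left₂′ left₁ (proj₂ (swap-width meets-right))) (cong width p≡)

  switch-endFrom : endFrom 0ℤ (proj₁ (switch ℓ (p , q))) ≡ endFrom 0ℤ q × endFrom 0ℤ (proj₂ (switch ℓ (p , q))) ≡ endFrom 0ℤ p
  switch-endFrom =
    trans (endFrom-uncentre-cong R₁′ R₂ left₁′ left₂ (proj₁ (swap-endFrom meets-right k))) (cong (endFrom 0ℤ) q≡) ,
    trans (endFrom-uncentre-cong R₂′ R₁ left₂′ left₁ (proj₂ (swap-endFrom meets-right k))) (cong (endFrom 0ℤ) p≡)

  switch-contains : Contains (proj₁ (switch ℓ (p , q))) ℓ k × Contains (proj₂ (switch ℓ (p , q))) ℓ k
  switch-contains = uncentre-contains left₁′ R₁′ , uncentre-contains left₂′ R₂′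

  switch-between : ∀ z → Between (height p z) (height q z) (height (proj₁ (switch ℓ (p , q))) z) ×
                         Between (height p z) (height q z) (height (proj₂ (switch ℓ (p , q))) z)
  switch-between z =
    Between-resp p-at q-at refl (uncentre-between R₁ R₂ R₁′ left₁ left₂ left₁′ (proj₁ ∘ swap-between meets-left k) (proj₁ ∘ swap-between meets-right k) z) ,
    Between-resp p-at q-at refl (uncentre-between R₁ R₂ R₂′ left₁ left₂ left₂′ (proj₂ ∘ swap-between meets-left k) (proj₂ ∘ swap-between meets-right k) z)
    where
    p-at = cong (λ p → height p z) (sym p≡)
    q-at = cong (λ q → height q z) (sym q≡)

  switch-involutive : switch ℓ (switch ℓ (p , q)) ≡ (p , q)
  switch-involutive = begin
    switch ℓ (uncentre (M₁′ , R₁′) , uncentre (M₂′ , R₂′))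
      ≡⟨ cong₂ (λ c₁ c₂ → recombine (swap (proj₁ c₁) (proj₁ c₂)) (swap (proj₂ c₁) (proj₂ c₂)))
               (centre-uncentre R₁′ (proj₁ left₁′)) (centre-uncentre R₂′ (proj₁ left₂′)) ⟩
    recombine (swap M₁′ M₂′) (swap R₁′ R₂′)
      ≡⟨ cong₂ recombine (swap-involutive meets-left) (swap-involutive meets-right) ⟩
    (uncentre (M₁ , R₁) , uncentre (M₂ , R₂))
      ≡⟨ cong₂ _,_ p≡ q≡ ⟩
    (p , q) ∎
    where open ≡-Reasoning

insideΓ-between : ∀ m ηm ηp p q p′ → (∀ z → Between (height p z) (height q z) (height p′ z)) →
  InsideΓ m ηm ηp p → InsideΓ m ηm ηp q → InsideΓ m ηm ηp p′
insideΓ-between m ηm ηp p q p′ between p-inside q-inside =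
  All.zipWith (λ {z} (p-bounds , q-bounds) → between-bounded p-bounds q-bounds (between z)) (p-inside , q-inside)

module _ (m : ℕ) (b : ℤ) (ηm ηp : Path) (ℓ : ℕ) where

  Through : ℤ → Path → Set
  Through y ζ = endFrom 0ℤ ζ ≡ b × InsideΓ m ηm ηp ζ × Contains ζ ℓ y

  through? : ∀ y ζ → Dec (Through y ζ)
  through? y ζ = (endFrom 0ℤ ζ ℤP.≟ b) ×-dec (insideΓ? m ηm ηp ζ ×-dec PtMem._∈?_ (ℓ , y) (verticesFrom 0 0ℤ ζ))

  -- F m b ηm ηp ℓ y is length (Paths y) by definition.
  Paths : ℤ → List Path
  Paths y = filter (through? y) (stepLists m)

  module _ (k : ℤ) {p q} (p∈ : p ∈ Paths (k + + 2)) (q∈ : q ∈ Paths (k - + 2)) where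

    private
      p-facts = ∈-filter⁻ (through? (k + + 2)) {xs = stepLists m} p∈
      q-facts = ∈-filter⁻ (through? (k - + 2)) {xs = stepLists m} q∈
      p-width = ∈stepLists⇒width m p (proj₁ p-facts)
      q-width = ∈stepLists⇒width m q (proj₁ q-facts)
      p-end = proj₁ (proj₂ p-facts)
      q-end = proj₁ (proj₂ q-facts)
      p-through = proj₂ (proj₂ (proj₂ p-facts))
      q-through = proj₂ (proj₂ (proj₂ q-facts))
      same-width = trans p-width (sym q-width)
      same-end = trans p-end (sym q-end)
      open Switched ℓ k p q p-through q-through same-width same-end
      inside : ∀ p′ → (∀ z → Between (height p z) (height q z) (height p′ z)) → InsideΓ m ηm ηp p′
      inside p′ b = insideΓ-between m ηm ηp p q p′ b (proj₁ (proj₂ (proj₂ p-facts))) (proj₁ (proj₂ (proj₂ q-facts)))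

    switch-∈ : switch ℓ (p , q) ∈ cartesianProduct (Paths k) (Paths k)
    switch-∈ = ∈-cartesianProduct⁺
      (∈-filter⁺ (through? k) (width⇒∈stepLists m P′ (trans (proj₁ switch-width) q-width))
                 (trans (proj₁ switch-endFrom) q-end , inside P′ (proj₁ ∘ switch-between) , proj₁ switch-contains))
      (∈-filter⁺ (through? k) (width⇒∈stepLists m Q′ (trans (proj₂ switch-width) p-width))
                 (trans (proj₂ switch-endFrom) p-end , inside Q′ (proj₂ ∘ switch-between) , proj₂ switch-contains))
      where
      P′ = proj₁ (switch ℓ (p , q))
      Q′ = proj₂ (switch ℓ (p , q))

    switch-involutive-∈ : switch ℓ (switch ℓ (p , q)) ≡ (p , q)
    switch-involutive-∈ = switch-involutive

  Paths-log-concave : ∀ k → length (Paths (k + + 2)) * length (Paths (k - + 2)) ≤ length (Paths k) * length (Paths k)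
  Paths-log-concave k =
    subst₂ _≤_ (length-cartesianProduct (Paths (k + + 2)) (Paths (k - + 2))) (length-cartesianProduct (Paths k) (Paths k))
      (injective⇒length≤ pairs (cartesianProduct (Paths k) (Paths k)) (switch ℓ)
        (Unique.cartesianProduct⁺ (Unique.filter⁺ (through? (k + + 2)) (stepLists-unique m))
                                  (Unique.filter⁺ (through? (k - + 2)) (stepLists-unique m)))
        (λ pq∈ → switch-∈ k (proj₁ (split pq∈)) (proj₂ (split pq∈)))
        (λ pq∈ pq′∈ eq → trans (sym (involutive pq∈)) (trans (cong (switch ℓ) eq) (involutive pq′∈))))
    where
    pairs = cartesianProduct (Paths (k + + 2)) (Paths (k - + 2))
    split = ∈-cartesianProduct⁻ (Paths (k + + 2)) (Paths (k - + 2))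
    involutive : ∀ {pq} → pq ∈ pairs → switch ℓ (switch ℓ pq) ≡ pq
    involutive pq∈ = switch-involutive-∈ k (proj₁ (split pq∈)) (proj₂ (split pq∈))

-- The switching argument uses none of the hypotheses on η₋, η₊, ℓ and the points (ℓ, k ± 2).
corollary4p4 : (m : ℕ) (b : ℤ) (ηm ηp : Path) → 0 < m →
    IsSchröder m b ηm → IsSchröder m b ηp → NonIntersectingAbove m ηm ηp →
    (ℓ : ℕ) → 0 < ℓ → ℓ < m → (k : ℤ) →
    InGamma ηm ηp ℓ (k + + 2) → InGamma ηm ηp ℓ (k - + 2) →
    F m b ηm ηp ℓ (k + + 2) * F m b ηm ηp ℓ (k - + 2)
      ≤ F m b ηm ηp ℓ k * F m b ηm ηp ℓ k
corollary4p4 m b ηm ηp _ _ _ _ ℓ _ _ k _ _ = Paths-log-concave m b ηm ηp ℓ k
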